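{- The set $\mathcal{B}$ of all blocking games is integer-invertible: for every integer $n\ge0$, $n,\overline{n}\in\mathcal{B}$ and $n+\overline{n}\equiv_{\mathcal{B}}0$.
   Context: Games are short misère-play game forms; outcomes $o(G)\in\{\mathscr{L},\mathscr{N},\mathscr{P},\mathscr{R}\}$ ordered $\mathscr{L}>\mathscr{N}>\mathscr{R}$, $\mathscr{L}>\mathscr{P}>\mathscr{R}$. $+$ is disjunctive sum; $0=\{\cdot\mid\cdot\}$; for $n\ge1$ the integer $n$ is $\{n-1\mid\cdot\}$ and $\overline{n}$ is its conjugate. $G\geq_{\mathcal{B}}H$ iff $o(G+X)\geq o(H+X)$ for all $X\in\mathcal{B}$; $G\equiv_{\mathcal{B}}H$ iff both $G\geq_{\mathcal{B}}H$ and $H\geq_{\mathcal{B}}G$. A subposition is any game reachable by a possibly empty, not necessarily alternating, sequence of moves. A Left end is a game with no Left options. A Left end $X$ is blocked if for every Right option $X^R$, either $X^R$ is a blocked Left end or some Left option $X^{RL}$ of $X^R$ is a blocked Left end; blocked Right ends symmetrically. A game is blocking if every subposition that is a Left (resp. Right) end is a blocked Left (resp. Right) end. -}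

module Defs where

open import Data.Nat using (ℕ; zero; suc)
open import Data.Bool using (Bool; true; false; not; _∨_; _∧_)
open import Data.List using (List; []; _∷_; _++_)
open import Data.List.Relation.Unary.All using (All)
open import Data.List.Relation.Unary.Any using (Any)
open import Data.List.Membership.Propositional using (_∈_)
open import Data.Sum using (_⊎_)
open import Data.Product using (_×_)
open import Relation.Binary.PropositionalEquality using (_≡_)

data Game : Set where
  mk : List Game → List Game → Game

leftOpts : Game → List Game
leftOpts (mk L _) = L

rightOpts : Game → List Game
rightOpts (mk _ R) = R

-- Misère play: a player with no move available on their turn WINS.
-- lf G : Left wins G moving first;  rf G : Right wins G moving first.
mutual
  lf : Game → Bool
  lf (mk [] _) = true
  lf (mk (g ∷ gs) _) = anyNotRf (g ∷ gs)

  rf : Game → Bool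
  rf (mk _ []) = true
  rf (mk _ (g ∷ gs)) = anyNotLf (g ∷ gs)

  anyNotRf : List Game → Bool
  anyNotRf [] = false
  anyNotRf (g ∷ gs) = not (rf g) ∨ anyNotRf gs

  anyNotLf : List Game → Bool
  anyNotLf [] = false
  anyNotLf (g ∷ gs) = not (lf g) ∨ anyNotLf gs

data Outcome : Set where
  𝓛 𝓝 𝓟 𝓡 : Outcome

outcomeOf : Bool → Bool → Outcome
outcomeOf true  false = 𝓛
outcomeOf true  true  = 𝓝
outcomeOf false false = 𝓟
outcomeOf false true  = 𝓡

o : Game → Outcome
o G = outcomeOf (lf G) (rf G)

data _≥o_ : Outcome → Outcome → Set where
  refl≥ : ∀ {x} → x ≥o x
  L≥N : 𝓛 ≥o 𝓝
  L≥P : 𝓛 ≥o 𝓟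
  L≥R : 𝓛 ≥o 𝓡
  N≥R : 𝓝 ≥o 𝓡
  P≥R : 𝓟 ≥o 𝓡

mutual
  _+_ : Game → Game → Game
  mk GL GR + mk HL HR =
    mk (plusL GL (mk HL HR) ++ plusR (mk GL GR) HL)
       (plusL GR (mk HL HR) ++ plusR (mk GL GR) HR)

  plusL : List Game → Game → List Game
  plusL [] H = []
  plusL (g ∷ gs) H = (g + H) ∷ plusL gs H

  plusR : Game → List Game → List Game
  plusR G [] = []
  plusR G (h ∷ hs) = (G + h) ∷ plusR G hs

mutual
  conj : Game → Game
  conj (mk L R) = mk (conjs R) (conjs L)

  conjs : List Game → List Game
  conjs [] = []
  conjs (g ∷ gs) = conj g ∷ conjs gs

zeroG : Game
zeroG = mk [] []

int : ℕ → Game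
int zero = zeroG
int (suc n) = mk (int n ∷ []) []

data _≼_ : Game → Game → Set where
  here : ∀ {G} → G ≼ G
  viaL : ∀ {K H G} → H ∈ leftOpts G → K ≼ H → K ≼ G
  viaR : ∀ {K H G} → H ∈ rightOpts G → K ≼ H → K ≼ G

data BlockedL : Game → Set where
  blockedL : ∀ {R} →
    All (λ XR → BlockedL XR ⊎ Any BlockedL (leftOpts XR)) R →
    BlockedL (mk [] R)

data BlockedR : Game → Set where
  blockedR : ∀ {L} →
    All (λ XL → BlockedR XL ⊎ Any BlockedR (rightOpts XL)) L →
    BlockedR (mk L [])

Blocking : Game → Set
Blocking G = ∀ K → K ≼ G →
  (leftOpts K ≡ [] → BlockedL K) × (rightOpts K ≡ [] → BlockedR K)

_≥B_ : Game → Game → Set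
G ≥B H = ∀ X → Blocking X → o (G + X) ≥o o (H + X)

_≡B_ : Game → Game → Set
G ≡B H = (G ≥B H) × (H ≥B G)

{-# OPTIONS --safe #-}
module Submission where

-- Against a blocking X, the player who wins X keeps winning n + n̄ + X by following
-- the winning line in X and answering a move in k or k̄ by the matching move in the
-- other component, back to (k-1) + (k-1)‾. This mirroring is unavailable only when X
-- reaches an end at which the player to move wins by being stuck, say a Left end. That
-- end is blocked, and in a + b̄ + Y with Y a blocked Left end and a ≤ b Left just plays
-- down a: Right, with more moves left in b̄, is never stuck, and a Right move in Y is
-- again a blocked Left end or has a Left option that is one; so Left is the one left
-- without a move, which wins in misère play.

open import Defs
open import Data.Nat using (ℕ; zero; suc; _≤_; _<_; s≤s)
open import Data.Nat.Properties using (≤-refl; m≤n⇒m≤1+n)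
open import Data.Bool using (true; false; not)
open import Data.Bool.Properties using (¬-not; ∨-zeroʳ)
open import Data.Product using (_×_; _,_; ∃-syntax; proj₁; proj₂)
open import Data.Sum using (_⊎_; inj₁; inj₂)
open import Data.List using ([]; _∷_; _++_; map)
open import Data.List.Relation.Unary.All as All using ([]; _∷_)
open import Data.List.Relation.Unary.Any using (Any; here; there)
open import Data.List.Relation.Unary.Any.Properties using (singleton⁻)
open import Data.List.Membership.Propositional using (_∈_; find; lose)
open import Data.List.Membership.Propositional.Properties using (∈-map⁺; ∈-map⁻; ∈-++⁺ˡ; ∈-++⁺ʳ; ∈-++⁻)
open import Function using (_∘_)
open import Relation.Nullary using (contradiction)
open import Relation.Binary.PropositionalEquality using (_≡_; refl; sym; trans; cong; cong₂; subst)
open import Induction.WellFounded using (WellFounded; Acc; acc)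

_⊏_ : Game → Game → Set
H ⊏ G = H ∈ leftOpts G ⊎ H ∈ rightOpts G

-- The termination checker does not see a member of L as smaller than mk L R, so
-- induction on games goes through accessibility.
mutual
  ⊏-wellFounded : WellFounded _⊏_
  ⊏-wellFounded (mk L R) = acc λ { (inj₁ H∈L) → members-acc L H∈L ; (inj₂ H∈R) → members-acc R H∈R }

  members-acc : ∀ {H} Gs → H ∈ Gs → Acc _⊏_ H
  members-acc (G ∷ _)  (here refl)  = ⊏-wellFounded G
  members-acc (_ ∷ Gs) (there H∈Gs) = members-acc Gs H∈Gs

plusL≡map : ∀ Gs H → plusL Gs H ≡ map (_+ H) Gs
plusL≡map []       H = refl
plusL≡map (G ∷ Gs) H = cong (G + H ∷_) (plusL≡map Gs H)

plusR≡map : ∀ G Hs → plusR G Hs ≡ map (G +_) Hs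
plusR≡map G []       = refl
plusR≡map G (H ∷ Hs) = cong (G + H ∷_) (plusR≡map G Hs)

+-leftOpts : ∀ A Y → leftOpts (A + Y) ≡ map (_+ Y) (leftOpts A) ++ map (A +_) (leftOpts Y)
+-leftOpts (mk AL _) (mk YL _) = cong₂ _++_ (plusL≡map AL _) (plusR≡map _ YL)

+-rightOpts : ∀ A Y → rightOpts (A + Y) ≡ map (_+ Y) (rightOpts A) ++ map (A +_) (rightOpts Y)
+-rightOpts (mk _ AR) (mk _ YR) = cong₂ _++_ (plusL≡map AR _) (plusR≡map _ YR)

module _ (A Y : Game) where

  +-leftOpt-left : ∀ {a} → a ∈ leftOpts A → a + Y ∈ leftOpts (A + Y)
  +-leftOpt-left a∈ = subst (_ ∈_) (sym (+-leftOpts A Y)) (∈-++⁺ˡ (∈-map⁺ (_+ Y) a∈))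

  +-leftOpt-right : ∀ {y} → y ∈ leftOpts Y → A + y ∈ leftOpts (A + Y)
  +-leftOpt-right y∈ = subst (_ ∈_) (sym (+-leftOpts A Y)) (∈-++⁺ʳ _ (∈-map⁺ (A +_) y∈))

  +-rightOpt-left : ∀ {a} → a ∈ rightOpts A → a + Y ∈ rightOpts (A + Y)
  +-rightOpt-left a∈ = subst (_ ∈_) (sym (+-rightOpts A Y)) (∈-++⁺ˡ (∈-map⁺ (_+ Y) a∈))

  +-rightOpt-right : ∀ {y} → y ∈ rightOpts Y → A + y ∈ rightOpts (A + Y)
  +-rightOpt-right y∈ = subst (_ ∈_) (sym (+-rightOpts A Y)) (∈-++⁺ʳ _ (∈-map⁺ (A +_) y∈))

  +-leftOpt-cases : ∀ {h} → h ∈ leftOpts (A + Y) →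
    (∃[ a ] a ∈ leftOpts A × h ≡ a + Y) ⊎ (∃[ y ] y ∈ leftOpts Y × h ≡ A + y)
  +-leftOpt-cases h∈ with ∈-++⁻ _ (subst (_ ∈_) (+-leftOpts A Y) h∈)
  ... | inj₁ h∈ˡ = inj₁ (∈-map⁻ (_+ Y) h∈ˡ)
  ... | inj₂ h∈ʳ = inj₂ (∈-map⁻ (A +_) h∈ʳ)

  +-rightOpt-cases : ∀ {h} → h ∈ rightOpts (A + Y) →
    (∃[ a ] a ∈ rightOpts A × h ≡ a + Y) ⊎ (∃[ y ] y ∈ rightOpts Y × h ≡ A + y)
  +-rightOpt-cases h∈ with ∈-++⁻ _ (subst (_ ∈_) (+-rightOpts A Y) h∈)
  ... | inj₁ h∈ˡ = inj₁ (∈-map⁻ (_+ Y) h∈ˡ)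
  ... | inj₂ h∈ʳ = inj₂ (∈-map⁻ (A +_) h∈ʳ)

+-leftEnd : ∀ A Y → leftOpts A ≡ [] → leftOpts Y ≡ [] → leftOpts (A + Y) ≡ []
+-leftEnd (mk [] _) (mk [] _) refl refl = refl

+-rightEnd : ∀ A Y → rightOpts A ≡ [] → rightOpts Y ≡ [] → rightOpts (A + Y) ≡ []
+-rightEnd (mk _ []) (mk _ []) refl refl = refl

anyNotRf-true⁺ : ∀ {Gs} → Any (λ G → rf G ≡ false) Gs → anyNotRf Gs ≡ true
anyNotRf-true⁺ (here rfG) rewrite rfG = refl
anyNotRf-true⁺ {G ∷ _} (there rfGs) rewrite anyNotRf-true⁺ rfGs = ∨-zeroʳ (not (rf G))

anyNotRf-true⁻ : ∀ Gs → anyNotRf Gs ≡ true → Any (λ G → rf G ≡ false) Gs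
anyNotRf-true⁻ (G ∷ Gs) e with rf G in rfG
... | false = here rfG
... | true  = there (anyNotRf-true⁻ Gs e)

anyNotRf-false : ∀ Gs → (∀ {G} → G ∈ Gs → rf G ≡ true) → anyNotRf Gs ≡ false
anyNotRf-false []       _   = refl
anyNotRf-false (G ∷ Gs) rfs rewrite rfs (here refl) = anyNotRf-false Gs (rfs ∘ there)

anyNotLf-true⁺ : ∀ {Gs} → Any (λ G → lf G ≡ false) Gs → anyNotLf Gs ≡ true
anyNotLf-true⁺ (here lfG) rewrite lfG = refl
anyNotLf-true⁺ {G ∷ _} (there lfGs) rewrite anyNotLf-true⁺ lfGs = ∨-zeroʳ (not (lf G))

anyNotLf-true⁻ : ∀ Gs → anyNotLf Gs ≡ true → Any (λ G → lf G ≡ false) Gs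
anyNotLf-true⁻ (G ∷ Gs) e with lf G in lfG
... | false = here lfG
... | true  = there (anyNotLf-true⁻ Gs e)

anyNotLf-false : ∀ Gs → (∀ {G} → G ∈ Gs → lf G ≡ true) → anyNotLf Gs ≡ false
anyNotLf-false []       _   = refl
anyNotLf-false (G ∷ Gs) lfs rewrite lfs (here refl) = anyNotLf-false Gs (lfs ∘ there)

lf-end : ∀ G → leftOpts G ≡ [] → lf G ≡ true
lf-end (mk [] _) refl = refl

lf-move : ∀ G {g} → g ∈ leftOpts G → rf g ≡ false → lf G ≡ true
lf-move (mk (_ ∷ _) _) g∈ rfg = anyNotRf-true⁺ (lose g∈ rfg)

lf-cases : ∀ G → lf G ≡ true → leftOpts G ≡ [] ⊎ ∃[ g ] g ∈ leftOpts G × rf g ≡ false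
lf-cases (mk []       _) _   = inj₁ refl
lf-cases (mk (g ∷ gs) _) lfG = inj₂ (find (anyNotRf-true⁻ (g ∷ gs) lfG))

lf-false : ∀ G {g} → g ∈ leftOpts G → (∀ {h} → h ∈ leftOpts G → rf h ≡ true) → lf G ≡ false
lf-false (mk (g ∷ gs) _) _ rfs = anyNotRf-false (g ∷ gs) rfs

lf-false-options : ∀ G {h} → lf G ≡ false → h ∈ leftOpts G → rf h ≡ true
lf-false-options G lfG h∈ = ¬-not λ rfh → contradiction (trans (sym (lf-move G h∈ rfh)) lfG) λ ()

lf-false-nonend : ∀ G → lf G ≡ false → ∃[ g ] g ∈ leftOpts G
lf-false-nonend (mk (g ∷ _) _) _ = g , here refl

rf-end : ∀ G → rightOpts G ≡ [] → rf G ≡ true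
rf-end (mk _ []) refl = refl

rf-move : ∀ G {g} → g ∈ rightOpts G → lf g ≡ false → rf G ≡ true
rf-move (mk _ (_ ∷ _)) g∈ lfg = anyNotLf-true⁺ (lose g∈ lfg)

rf-cases : ∀ G → rf G ≡ true → rightOpts G ≡ [] ⊎ ∃[ g ] g ∈ rightOpts G × lf g ≡ false
rf-cases (mk _ [])       _   = inj₁ refl
rf-cases (mk _ (g ∷ gs)) rfG = inj₂ (find (anyNotLf-true⁻ (g ∷ gs) rfG))

rf-false : ∀ G {g} → g ∈ rightOpts G → (∀ {h} → h ∈ rightOpts G → lf h ≡ true) → rf G ≡ false
rf-false (mk _ (g ∷ gs)) _ lfs = anyNotLf-false (g ∷ gs) lfs

rf-false-options : ∀ G {h} → rf G ≡ false → h ∈ rightOpts G → lf h ≡ true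
rf-false-options G rfG h∈ = ¬-not λ lfh → contradiction (trans (sym (rf-move G h∈ lfh)) rfG) λ ()

rf-false-nonend : ∀ G → rf G ≡ false → ∃[ g ] g ∈ rightOpts G
rf-false-nonend (mk _ (g ∷ _)) _ = g , here refl

infix 25 _⊖_
_⊖_ : ℕ → ℕ → Game
a ⊖ b = int a + conj (int b)

⊖-leftOpts : ∀ a b → leftOpts (suc a ⊖ b) ≡ a ⊖ b ∷ []
⊖-leftOpts a zero    = refl
⊖-leftOpts a (suc b) = refl

⊖-rightOpts : ∀ a b → rightOpts (a ⊖ suc b) ≡ a ⊖ b ∷ []
⊖-rightOpts zero    b = refl
⊖-rightOpts (suc a) b = refl

⊖-leftEnd : ∀ b → leftOpts (0 ⊖ b) ≡ []
⊖-leftEnd zero    = refl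
⊖-leftEnd (suc b) = refl

⊖-rightEnd : ∀ a → rightOpts (a ⊖ 0) ≡ []
⊖-rightEnd zero    = refl
⊖-rightEnd (suc a) = refl

⊖-leftOpt : ∀ a b → a ⊖ b ∈ leftOpts (suc a ⊖ b)
⊖-leftOpt a b = subst (a ⊖ b ∈_) (sym (⊖-leftOpts a b)) (here refl)

⊖-rightOpt : ∀ a b → a ⊖ b ∈ rightOpts (a ⊖ suc b)
⊖-rightOpt a b = subst (a ⊖ b ∈_) (sym (⊖-rightOpts a b)) (here refl)

⊖-leftOpt⁻ : ∀ {g} a b → g ∈ leftOpts (suc a ⊖ b) → g ≡ a ⊖ b
⊖-leftOpt⁻ a b g∈ = singleton⁻ (subst (_ ∈_) (⊖-leftOpts a b) g∈)

⊖-rightOpt⁻ : ∀ {g} a b → g ∈ rightOpts (a ⊖ suc b) → g ≡ a ⊖ b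
⊖-rightOpt⁻ a b g∈ = singleton⁻ (subst (_ ∈_) (⊖-rightOpts a b) g∈)

mutual
  blockedL-lf : ∀ a b {Y} → a ≤ b → BlockedL Y → Acc _⊏_ Y → lf (a ⊖ b + Y) ≡ true
  blockedL-lf zero b {Y} _ (blockedL _) _ = lf-end (0 ⊖ b + Y) (+-leftEnd (0 ⊖ b) Y (⊖-leftEnd b) refl)
  blockedL-lf (suc a) b {Y} a<b blY accY =
    lf-move (suc a ⊖ b + Y) (+-leftOpt-left (suc a ⊖ b) Y (⊖-leftOpt a b)) (blockedL-rf a b a<b blY accY)

  blockedL-rf : ∀ a b {Y} → a < b → BlockedL Y → Acc _⊏_ Y → rf (a ⊖ b + Y) ≡ false
  blockedL-rf a (suc b) {Y} (s≤s a≤b) (blockedL blocked) (acc smaller) =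
    rf-false (a ⊖ suc b + Y) (+-rightOpt-left (a ⊖ suc b) Y (⊖-rightOpt a b)) leftWins
    where
    leftWins : ∀ {h} → h ∈ rightOpts (a ⊖ suc b + Y) → lf h ≡ true
    leftWins h∈ with +-rightOpt-cases (a ⊖ suc b) Y h∈
    ... | inj₁ (r , r∈ , refl) rewrite ⊖-rightOpt⁻ a b r∈ =
      blockedL-lf a b a≤b (blockedL blocked) (acc smaller)
    ... | inj₂ (y , y∈ , refl) with All.lookup blocked y∈
    ...   | inj₁ blY = blockedL-lf a (suc b) (m≤n⇒m≤1+n a≤b) blY (smaller (inj₂ y∈))
    ...   | inj₂ blYL with find blYL | smaller (inj₂ y∈)
    ...     | yL , yL∈ , blYL' | acc smaller' =
      lf-move (a ⊖ suc b + y) (+-leftOpt-right (a ⊖ suc b) y yL∈)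
        (blockedL-rf a (suc b) (s≤s a≤b) blYL' (smaller' (inj₁ yL∈)))

mutual
  blockedR-rf : ∀ a b {Y} → b ≤ a → BlockedR Y → Acc _⊏_ Y → rf (a ⊖ b + Y) ≡ true
  blockedR-rf a zero {Y} _ (blockedR _) _ = rf-end (a ⊖ 0 + Y) (+-rightEnd (a ⊖ 0) Y (⊖-rightEnd a) refl)
  blockedR-rf a (suc b) {Y} b<a blY accY =
    rf-move (a ⊖ suc b + Y) (+-rightOpt-left (a ⊖ suc b) Y (⊖-rightOpt a b)) (blockedR-lf a b b<a blY accY)

  blockedR-lf : ∀ a b {Y} → b < a → BlockedR Y → Acc _⊏_ Y → lf (a ⊖ b + Y) ≡ false
  blockedR-lf (suc a) b {Y} (s≤s b≤a) (blockedR blocked) (acc smaller) =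
    lf-false (suc a ⊖ b + Y) (+-leftOpt-left (suc a ⊖ b) Y (⊖-leftOpt a b)) rightWins
    where
    rightWins : ∀ {h} → h ∈ leftOpts (suc a ⊖ b + Y) → rf h ≡ true
    rightWins h∈ with +-leftOpt-cases (suc a ⊖ b) Y h∈
    ... | inj₁ (l , l∈ , refl) rewrite ⊖-leftOpt⁻ a b l∈ =
      blockedR-rf a b b≤a (blockedR blocked) (acc smaller)
    ... | inj₂ (y , y∈ , refl) with All.lookup blocked y∈
    ...   | inj₁ blY = blockedR-rf (suc a) b (m≤n⇒m≤1+n b≤a) blY (smaller (inj₁ y∈))
    ...   | inj₂ blYR with find blYR | smaller (inj₁ y∈)
    ...     | yR , yR∈ , blYR' | acc smaller' =
      rf-move (suc a ⊖ b + y) (+-rightOpt-right (suc a ⊖ b) y yR∈)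
        (blockedR-lf (suc a) b (s≤s b≤a) blYR' (smaller' (inj₂ yR∈)))

blocking-leftOpt : ∀ {X x} → Blocking X → x ∈ leftOpts X → Blocking x
blocking-leftOpt blX x∈ K K≼x = blX K (viaL x∈ K≼x)

blocking-rightOpt : ∀ {X x} → Blocking X → x ∈ rightOpts X → Blocking x
blocking-rightOpt blX x∈ K K≼x = blX K (viaR x∈ K≼x)

mutual
  ⊖-cancel-lf-true : ∀ n {X} → Acc _⊏_ X → Blocking X → lf X ≡ true → lf (n ⊖ n + X) ≡ true
  ⊖-cancel-lf-true n {X} (acc smaller) blX lfX with lf-cases X lfX
  ... | inj₁ end = blockedL-lf n n ≤-refl (proj₁ (blX X here) end) (acc smaller)
  ... | inj₂ (x , x∈ , rfx) =
    lf-move (n ⊖ n + X) (+-leftOpt-right (n ⊖ n) X x∈)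
      (⊖-cancel-rf-false n (smaller (inj₁ x∈)) (blocking-leftOpt blX x∈) rfx)

  ⊖-cancel-rf-false : ∀ n {X} → Acc _⊏_ X → Blocking X → rf X ≡ false → rf (n ⊖ n + X) ≡ false
  ⊖-cancel-rf-false n {X} (acc smaller) blX rfX =
    rf-false (n ⊖ n + X) (+-rightOpt-right (n ⊖ n) X (proj₂ (rf-false-nonend X rfX))) leftWins
    where
    mirror : ∀ k {r} → r ∈ rightOpts (k ⊖ k) → lf (r + X) ≡ true
    mirror (suc k) (here refl) =
      lf-move (suc k ⊖ k + X) (+-leftOpt-left (suc k ⊖ k) X (⊖-leftOpt k k))
        (⊖-cancel-rf-false k (acc smaller) blX rfX)

    leftWins : ∀ {h} → h ∈ rightOpts (n ⊖ n + X) → lf h ≡ true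
    leftWins h∈ with +-rightOpt-cases (n ⊖ n) X h∈
    ... | inj₁ (r , r∈ , refl) = mirror n r∈
    ... | inj₂ (x , x∈ , refl) =
      ⊖-cancel-lf-true n (smaller (inj₂ x∈)) (blocking-rightOpt blX x∈) (rf-false-options X rfX x∈)

mutual
  ⊖-cancel-rf-true : ∀ n {X} → Acc _⊏_ X → Blocking X → rf X ≡ true → rf (n ⊖ n + X) ≡ true
  ⊖-cancel-rf-true n {X} (acc smaller) blX rfX with rf-cases X rfX
  ... | inj₁ end = blockedR-rf n n ≤-refl (proj₂ (blX X here) end) (acc smaller)
  ... | inj₂ (x , x∈ , lfx) =
    rf-move (n ⊖ n + X) (+-rightOpt-right (n ⊖ n) X x∈)
      (⊖-cancel-lf-false n (smaller (inj₂ x∈)) (blocking-rightOpt blX x∈) lfx)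

  ⊖-cancel-lf-false : ∀ n {X} → Acc _⊏_ X → Blocking X → lf X ≡ false → lf (n ⊖ n + X) ≡ false
  ⊖-cancel-lf-false n {X} (acc smaller) blX lfX =
    lf-false (n ⊖ n + X) (+-leftOpt-right (n ⊖ n) X (proj₂ (lf-false-nonend X lfX))) rightWins
    where
    mirror : ∀ k {l} → l ∈ leftOpts (k ⊖ k) → rf (l + X) ≡ true
    mirror (suc k) (here refl) =
      rf-move (k ⊖ suc k + X) (+-rightOpt-left (k ⊖ suc k) X (⊖-rightOpt k k))
        (⊖-cancel-lf-false k (acc smaller) blX lfX)

    rightWins : ∀ {h} → h ∈ leftOpts (n ⊖ n + X) → rf h ≡ true
    rightWins h∈ with +-leftOpt-cases (n ⊖ n) X h∈
    ... | inj₁ (l , l∈ , refl) = mirror n l∈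
    ... | inj₂ (x , x∈ , refl) =
      ⊖-cancel-rf-true n (smaller (inj₁ x∈)) (blocking-leftOpt blX x∈) (lf-false-options X lfX x∈)

⊖-cancel-lf : ∀ n {X} → Blocking X → lf (n ⊖ n + X) ≡ lf X
⊖-cancel-lf n {X} blX with lf X in lfX
... | true  = ⊖-cancel-lf-true n (⊏-wellFounded X) blX lfX
... | false = ⊖-cancel-lf-false n (⊏-wellFounded X) blX lfX

⊖-cancel-rf : ∀ n {X} → Blocking X → rf (n ⊖ n + X) ≡ rf X
⊖-cancel-rf n {X} blX with rf X in rfX
... | true  = ⊖-cancel-rf-true n (⊏-wellFounded X) blX rfX
... | false = ⊖-cancel-rf-false n (⊏-wellFounded X) blX rfX

⊖-cancel-o : ∀ n {X} → Blocking X → o (n ⊖ n + X) ≡ o X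
⊖-cancel-o n blX = cong₂ outcomeOf (⊖-cancel-lf n blX) (⊖-cancel-rf n blX)

int-subposition : ∀ {K} n → K ≼ int n → ∃[ k ] K ≡ int k
int-subposition n       here                     = n , refl
int-subposition (suc n) (viaL (here refl) K≼int) = int-subposition n K≼int
int-subposition (suc n) (viaL (there ()) _)
int-subposition zero    (viaL () _)
int-subposition zero    (viaR () _)
int-subposition (suc n) (viaR () _)

conj-int-subposition : ∀ {K} n → K ≼ conj (int n) → ∃[ k ] K ≡ conj (int k)
conj-int-subposition n       here                     = n , refl
conj-int-subposition (suc n) (viaR (here refl) K≼conj) = conj-int-subposition n K≼conj
conj-int-subposition (suc n) (viaR (there ()) _)
conj-int-subposition zero    (viaR () _)
conj-int-subposition zero    (viaL () _)
conj-int-subposition (suc n) (viaL () _)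

int-blockedL : ∀ k → leftOpts (int k) ≡ [] → BlockedL (int k)
int-blockedL zero _ = blockedL []

int-blockedR : ∀ k → BlockedR (int k)
int-blockedR zero    = blockedR []
int-blockedR (suc k) = blockedR (inj₁ (int-blockedR k) ∷ [])

conj-int-blockedL : ∀ k → BlockedL (conj (int k))
conj-int-blockedL zero    = blockedL []
conj-int-blockedL (suc k) = blockedL (inj₁ (conj-int-blockedL k) ∷ [])

conj-int-blockedR : ∀ k → rightOpts (conj (int k)) ≡ [] → BlockedR (conj (int k))
conj-int-blockedR zero _ = blockedR []

int-blocking : ∀ n → Blocking (int n)
int-blocking n K K≼int with int-subposition n K≼int
... | k , refl = int-blockedL k , λ _ → int-blockedR k

conj-int-blocking : ∀ n → Blocking (conj (int n))
conj-int-blocking n K K≼conj with conj-int-subposition n K≼conj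
... | k , refl = (λ _ → conj-int-blockedL k) , conj-int-blockedR k

≡B-from-outcomes : ∀ {G H} → (∀ {X} → Blocking X → o (G + X) ≡ o (H + X)) → G ≡B H
≡B-from-outcomes same =
  (λ X blX → subst (_ ≥o_) (same blX) refl≥) , (λ X blX → subst (_ ≥o_) (sym (same blX)) refl≥)

lemma4p5 : (n : ℕ) →
    Blocking (int n) × Blocking (conj (int n)) × ((int n + conj (int n)) ≡B zeroG)
lemma4p5 n = int-blocking n , conj-int-blocking n ,
  -- zeroG is 0 ⊖ 0 by computation.
  ≡B-from-outcomes {n ⊖ n} {zeroG} λ blX → trans (⊖-cancel-o n blX) (sym (⊖-cancel-o 0 blX))
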